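{- Let $e\geq 3$ be an integer and let $n>1$ be an integer with $n\equiv 1 \pmod{4e}$. Then there exists an $e$-star system of order $n$ which is $n$-block-colourable.
   Context: For an integer $e\ge 1$, an $e$-star is a copy of the complete bipartite graph $K_{1,e}$. An $e$-star system of order $n$ is a pair $(V,\mathcal{B})$ where $|V|=n$ and $\mathcal{B}$ is a set of $e$-stars (subgraphs of the complete graph $K_n$ on $V$) whose edge sets partition the edge set of $K_n$; the elements of $\mathcal B$ are called blocks. A block-colouring of such a system is a partition of $\mathcal{B}$ into colour classes such that the blocks in each colour class are pairwise vertex-disjoint. The system is $k$-block-colourable if it admits a block-colouring with $k$ colour classes. -}

module Defs where

open import Data.Nat using (ℕ; _≡ᵇ_)
open import Data.Fin using (Fin)
open import Data.List using (List; length; lookup)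
open import Data.List.Membership.Propositional using (_∈_; _∉_)
open import Data.List.Relation.Unary.Unique.Propositional using (Unique)
open import Data.Product using (Σ; ∃; ∃-syntax; _×_; _,_)
open import Data.Sum using (_⊎_)
open import Relation.Binary.PropositionalEquality using (_≡_; _≢_)
open import Relation.Nullary using (¬_)
open import Function.Definitions using (Surjective)

record Star (n e : ℕ) : Set where
  field
    centre     : Fin n
    leaves     : List (Fin n)
    leaves-len : length leaves ≡ e
    leaves-uniq : Unique leaves
    centre∉    : centre ∉ leaves
open Star public

HasEdge : ∀ {n e} → Star n e → Fin n → Fin n → Set
HasEdge s u v = (u ≡ centre s × v ∈ leaves s) ⊎ (v ≡ centre s × u ∈ leaves s)

HasVertex : ∀ {n e} → Star n e → Fin n → Set
HasVertex s v = v ≡ centre s ⊎ v ∈ leaves s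

ExactlyOne : ∀ {n e} (B : List (Star n e)) → Fin n → Fin n → Set
ExactlyOne B u v =
  Σ (Fin (length B)) λ i → HasEdge (lookup B i) u v ×
    (∀ j → HasEdge (lookup B j) u v → j ≡ i)

IsStarSystem : ∀ {n e} → List (Star n e) → Set
IsStarSystem {n} B = ∀ (u v : Fin n) → u ≢ v → ExactlyOne B u v

VertexDisjoint : ∀ {n e} → Star n e → Star n e → Set
VertexDisjoint {n} s t = ¬ (∃[ v ] (HasVertex s v × HasVertex t v))

-- a block-colouring with exactly k colour classes: a map from blocks onto
-- k colours (every class nonempty, so it is a partition into k classes)
-- such that distinct blocks of the same colour are vertex-disjoint.
IsBlockColouring : ∀ {n e} (B : List (Star n e)) (k : ℕ) →
                   (Fin (length B) → Fin k) → Set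
IsBlockColouring B k col =
  Surjective _≡_ _≡_ col ×
  (∀ i j → i ≢ j → col i ≡ col j → VertexDisjoint (lookup B i) (lookup B j))

BlockColourable : ∀ {n e} (B : List (Star n e)) (k : ℕ) → Set
BlockColourable B k = ∃[ col ] IsBlockColouring B k col

{-# OPTIONS --safe #-}
module Submission where

-- Work in ℤ/n with n = 2eG + 1.  The odd residues 1, 3, …, 2eG − 1 contain exactly one of
-- d and n − d for every d ≢ 0, and they split into G classes O_j = {2(Gi + j) + 1 : i < e}.
-- The stars with centre x and leaves x + O_j, over all j and x, therefore use every edge
-- {u, v} exactly once, namely through whichever of v − u and u − v is odd.  Give the block
-- (j, x) the colour c = x + j + 1: its centre is then c + (2eG − j) and its leaves are
-- c + (j + 2Gi), and these offsets from c determine j.  So blocks of one colour are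
-- vertex-disjoint, and the nG blocks fill exactly n colour classes.  Only e ≥ 1 and
-- n ≡ 1 (mod 2e) are needed.

open import Defs
open import Data.Empty using (⊥)
open import Data.Fin using (Fin; toℕ; fromℕ<; cast; combine; remQuot)
open import Data.Fin.Properties
  using (toℕ-fromℕ<; toℕ-injective; toℕ<n; cast-involutive; *↔×; toℕ-combine; combine-injective; combine-remQuot)
open import Data.List using (List; tabulate; length; lookup)
open import Data.List.Membership.Propositional using (_∈_)
open import Data.List.Membership.Propositional.Properties using (∈-tabulate⁺; ∈-tabulate⁻)
open import Data.List.Properties using (length-tabulate; lookup-tabulate)
open import Data.List.Relation.Unary.Unique.Propositional.Properties using (tabulate⁺)
open import Data.Nat
  using (ℕ; zero; suc; _+_; _*_; _∸_; _≤_; _<_; z≤n; s≤s; z<s; NonZero; >-nonZero; >-nonZero⁻¹)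
open import Data.Nat.Divisibility using (_∣_; divides; ∣-trans)
open import Data.Nat.DivMod
open import Data.Nat.Properties
open import Data.Nat.Solver using (module +-*-Solver)
open import Data.Product using (∃; ∃-syntax; _×_; _,_; proj₁; proj₂)
open import Data.Sum using (_⊎_; inj₁; inj₂)
open import Function using (_∘_; _↔_; Inverse)
open import Relation.Binary.PropositionalEquality
  using (_≡_; _≢_; refl; sym; trans; cong; subst; subst₂; module ≡-Reasoning)
open import Relation.Nullary using (yes; no; contradiction)

even-or-odd : ∀ d → (∃ λ t → d ≡ 2 * t) ⊎ (∃ λ t → d ≡ suc (2 * t))
even-or-odd zero = inj₁ (0 , refl)
even-or-odd (suc d) with even-or-odd d
... | inj₁ (t , refl) = inj₂ (t , refl)
... | inj₂ (t , refl) = inj₁ (suc t , sym (*-suc 2 t))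

HasEdge-sym : ∀ {n e} (s : Star n e) {u v} → HasEdge s u v → HasEdge s v u
HasEdge-sym s (inj₁ h) = inj₂ h
HasEdge-sym s (inj₂ h) = inj₁ h

ExactlyOne-sym : ∀ {n e} {B : List (Star n e)} {u v} → ExactlyOne B u v → ExactlyOne B v u
ExactlyOne-sym {B = B} (k , h , unique) =
  k , HasEdge-sym (lookup B k) h , λ l h′ → unique l (HasEdge-sym (lookup B l) h′)

module Enumeration {a i} {A : Set a} {I : Set i} {m : ℕ} (ι : Fin m ↔ I) (f : I → A) where
  open Inverse ι using (to; from; strictlyInverseˡ; strictlyInverseʳ)

  list : List A
  list = tabulate (f ∘ to)

  private
    length-list : length list ≡ m
    length-list = length-tabulate (f ∘ to)

  label : Fin (length list) → I
  label k = to (cast length-list k)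

  slot : I → Fin (length list)
  slot p = cast (sym length-list) (from p)

  lookup-list : ∀ k → lookup list k ≡ f (label k)
  lookup-list k = begin
    lookup list k
      ≡⟨ cong (lookup list) (cast-involutive (sym length-list) length-list k) ⟨
    lookup list (cast (sym length-list) (cast length-list k))
      ≡⟨ lookup-tabulate (f ∘ to) (cast length-list k) ⟩
    f (label k)
      ∎
    where open ≡-Reasoning

  label-slot : ∀ p → label (slot p) ≡ p
  label-slot p = trans (cong to (cast-involutive length-list (sym length-list) (from p))) (strictlyInverseˡ p)

  slot-label : ∀ k → slot (label k) ≡ k
  slot-label k = trans (cong (cast (sym length-list)) (strictlyInverseʳ (cast length-list k)))
                           (cast-involutive (sym length-list) length-list k)

  label-injective : ∀ {k l} → label k ≡ label l → k ≡ l
  label-injective {k} {l} eq = trans (sym (slot-label k)) (trans (cong slot eq) (slot-label l))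

  lookup-slot : ∀ p → lookup list (slot p) ≡ f p
  lookup-slot p = trans (lookup-list (slot p)) (cong f (label-slot p))

module Cyclic (N : ℕ) .{{_ : NonZero N}} where

  infixl 6 _⊕_
  _⊕_ : Fin N → ℕ → Fin N
  x ⊕ d = (toℕ x + d) mod N

  toℕ-⊕ : ∀ x d → toℕ (x ⊕ d) ≡ (toℕ x + d) % N
  toℕ-⊕ x d = toℕ-fromℕ< (m%n<n (toℕ x + d) N)

  ⊕-% : ∀ x a → x ⊕ a % N ≡ x ⊕ a
  ⊕-% x a = toℕ-injective (begin
    toℕ (x ⊕ a % N)               ≡⟨ toℕ-⊕ x (a % N) ⟩
    (toℕ x + a % N) % N           ≡⟨ %-distribˡ-+ (toℕ x) (a % N) N ⟩
    (toℕ x % N + a % N % N) % N   ≡⟨ cong (λ r → (toℕ x % N + r) % N) (m%n%n≡m%n a N) ⟩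
    (toℕ x % N + a % N) % N       ≡⟨ %-distribˡ-+ (toℕ x) a N ⟨
    (toℕ x + a) % N               ≡⟨ toℕ-⊕ x a ⟨
    toℕ (x ⊕ a)                   ∎)
    where open ≡-Reasoning

  ⊕-assoc : ∀ x a b → x ⊕ a ⊕ b ≡ x ⊕ (a + b)
  ⊕-assoc x a b = toℕ-injective (begin
    toℕ (x ⊕ a ⊕ b)               ≡⟨ toℕ-⊕ (x ⊕ a) b ⟩
    (toℕ (x ⊕ a) + b) % N         ≡⟨ cong (λ r → (r + b) % N) (toℕ-⊕ x a) ⟩
    ((toℕ x + a) % N + b) % N     ≡⟨ %-distribˡ-+ ((toℕ x + a) % N) b N ⟩
    ((toℕ x + a) % N % N + b % N) % N ≡⟨ cong (λ r → (r + b % N) % N) (m%n%n≡m%n (toℕ x + a) N) ⟩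
    ((toℕ x + a) % N + b % N) % N ≡⟨ %-distribˡ-+ (toℕ x + a) b N ⟨
    (toℕ x + a + b) % N           ≡⟨ cong (_% N) (+-assoc (toℕ x) a b) ⟩
    (toℕ x + (a + b)) % N         ≡⟨ toℕ-⊕ x (a + b) ⟨
    toℕ (x ⊕ (a + b))             ∎)
    where open ≡-Reasoning

  ⊕-identityʳ : ∀ x → x ⊕ 0 ≡ x
  ⊕-identityʳ x = toℕ-injective (begin
    toℕ (x ⊕ 0)      ≡⟨ toℕ-⊕ x 0 ⟩
    (toℕ x + 0) % N  ≡⟨ cong (_% N) (+-identityʳ (toℕ x)) ⟩
    toℕ x % N        ≡⟨ m<n⇒m%n≡m (toℕ<n x) ⟩
    toℕ x            ∎)
    where open ≡-Reasoning

  ⊕-N : ∀ x → x ⊕ N ≡ x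
  ⊕-N x = toℕ-injective (begin
    toℕ (x ⊕ N)      ≡⟨ toℕ-⊕ x N ⟩
    (toℕ x + N) % N  ≡⟨ [m+n]%n≡m%n (toℕ x) N ⟩
    toℕ x % N        ≡⟨ m<n⇒m%n≡m (toℕ<n x) ⟩
    toℕ x            ∎)
    where open ≡-Reasoning

  ⊕-N+ : ∀ x a → x ⊕ (N + a) ≡ x ⊕ a
  ⊕-N+ x a = trans (sym (⊕-assoc x N a)) (cong (_⊕ a) (⊕-N x))

  ⊕-⊕∸ : ∀ x {a} → a ≤ N → x ⊕ a ⊕ (N ∸ a) ≡ x
  ⊕-⊕∸ x {a} a≤N = begin
    x ⊕ a ⊕ (N ∸ a)    ≡⟨ ⊕-assoc x a (N ∸ a) ⟩
    x ⊕ (a + (N ∸ a))  ≡⟨ cong (x ⊕_) (m+[n∸m]≡n a≤N) ⟩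
    x ⊕ N              ≡⟨ ⊕-N x ⟩
    x                  ∎
    where open ≡-Reasoning

  ⊕-∸⊕ : ∀ x {a} → a ≤ N → x ⊕ (N ∸ a) ⊕ a ≡ x
  ⊕-∸⊕ x {a} a≤N = begin
    x ⊕ (N ∸ a) ⊕ a    ≡⟨ ⊕-assoc x (N ∸ a) a ⟩
    x ⊕ (N ∸ a + a)    ≡⟨ cong (x ⊕_) (m∸n+n≡m a≤N) ⟩
    x ⊕ N              ≡⟨ ⊕-N x ⟩
    x                  ∎
    where open ≡-Reasoning

  ⊕-cancelʳ : ∀ {x y a} → a ≤ N → x ⊕ a ≡ y ⊕ a → x ≡ y
  ⊕-cancelʳ {x} {y} {a} a≤N eq =
    trans (sym (⊕-⊕∸ x a≤N)) (trans (cong (_⊕ (N ∸ a)) eq) (⊕-⊕∸ y a≤N))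

  toℕ-⊕-+∸ : ∀ x {a} → a < N → toℕ (x ⊕ (a + (N ∸ toℕ x))) ≡ a
  toℕ-⊕-+∸ x {a} a<N = begin
    toℕ (x ⊕ (a + (N ∸ X)))   ≡⟨ toℕ-⊕ x (a + (N ∸ X)) ⟩
    (X + (a + (N ∸ X))) % N   ≡⟨ cong (_% N) (+-comm X (a + (N ∸ X))) ⟩
    (a + (N ∸ X) + X) % N     ≡⟨ cong (_% N) (+-assoc a (N ∸ X) X) ⟩
    (a + (N ∸ X + X)) % N     ≡⟨ cong (λ r → (a + r) % N) (m∸n+n≡m (<⇒≤ (toℕ<n x))) ⟩
    (a + N) % N               ≡⟨ [m+n]%n≡m%n a N ⟩
    a % N                     ≡⟨ m<n⇒m%n≡m a<N ⟩
    a                         ∎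
    where
    open ≡-Reasoning
    X : ℕ
    X = toℕ x

  ⊕-cancelˡ : ∀ {x a b} → a < N → b < N → x ⊕ a ≡ x ⊕ b → a ≡ b
  ⊕-cancelˡ {x} {a} {b} a<N b<N eq = begin
    a                          ≡⟨ toℕ-⊕-+∸ x a<N ⟨
    toℕ (x ⊕ (a + (N ∸ X)))    ≡⟨ cong toℕ (⊕-assoc x a (N ∸ X)) ⟨
    toℕ (x ⊕ a ⊕ (N ∸ X))      ≡⟨ cong (λ y → toℕ (y ⊕ (N ∸ X))) eq ⟩
    toℕ (x ⊕ b ⊕ (N ∸ X))      ≡⟨ cong toℕ (⊕-assoc x b (N ∸ X)) ⟩
    toℕ (x ⊕ (b + (N ∸ X)))    ≡⟨ toℕ-⊕-+∸ x b<N ⟩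
    b                          ∎
    where
    open ≡-Reasoning
    X : ℕ
    X = toℕ x

  difference : ∀ u v → ∃[ d ] d < N × u ⊕ d ≡ v
  difference u v = d , m%n<n (V + (N ∸ U)) N , toℕ-injective (begin
    toℕ (u ⊕ d)                ≡⟨ cong toℕ (⊕-% u (V + (N ∸ U))) ⟩
    toℕ (u ⊕ (V + (N ∸ U)))    ≡⟨ toℕ-⊕-+∸ u (toℕ<n v) ⟩
    V                          ∎)
    where
    open ≡-Reasoning
    U V d : ℕ
    U = toℕ u
    V = toℕ v
    d = (V + (N ∸ U)) % N

  ⊕-period : ∀ x {s} → 0 < s → s < N + N → x ⊕ s ≡ x → s ≡ N
  ⊕-period x {s} 0<s s<2N eq with s <? N
  ... | yes s<N = contradiction (⊕-cancelˡ s<N (>-nonZero⁻¹ N) (trans eq (sym (⊕-identityʳ x)))) (>⇒≢ 0<s)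
  ... | no s≮N = begin
    s            ≡⟨ m+[n∸m]≡n N≤s ⟨
    N + r        ≡⟨ cong (N +_) r≡0 ⟩
    N + 0        ≡⟨ +-identityʳ N ⟩
    N            ∎
    where
    open ≡-Reasoning
    N≤s : N ≤ s
    N≤s = ≮⇒≥ s≮N
    r : ℕ
    r = s ∸ N
    r<N : r < N
    r<N = +-cancelˡ-< N r N (subst (_< N + N) (sym (m+[n∸m]≡n N≤s)) s<2N)
    r≡0 : r ≡ 0
    r≡0 = ⊕-cancelˡ r<N (>-nonZero⁻¹ N) (begin
      x ⊕ r        ≡⟨ ⊕-N+ x r ⟨
      x ⊕ (N + r)  ≡⟨ cong (x ⊕_) (m+[n∸m]≡n N≤s) ⟩
      x ⊕ s        ≡⟨ eq ⟩
      x            ≡⟨ ⊕-identityʳ x ⟨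
      x ⊕ 0        ∎)

module CyclicStarSystem
  (N e G : ℕ) .{{_ : NonZero N}} (offset : Fin G → Fin e → ℕ)
  (offset-positive : ∀ j i → 0 < offset j i)
  (offset-< : ∀ j i → offset j i < N)
  (offset-injective : ∀ {j i j′ i′} → offset j i ≡ offset j′ i′ → j ≡ j′ × i ≡ i′)
  (offset-covers : ∀ {d d′} → 0 < d → 0 < d′ → d + d′ ≡ N →
                   (∃[ j ] ∃[ i ] offset j i ≡ d) ⊎ (∃[ j ] ∃[ i ] offset j i ≡ d′))
  (offset-sum≢N : ∀ j i j′ i′ → offset j i + offset j′ i′ ≢ N)
  where

  open Cyclic N

  Spoke : Fin G → Fin N → Fin N → Set
  Spoke j u v = ∃[ i ] v ≡ u ⊕ offset j i

  star : Fin G × Fin N → Star N e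
  star (j , x) = record
    { centre      = x
    ; leaves      = tabulate (λ i → x ⊕ offset j i)
    ; leaves-len  = length-tabulate (λ i → x ⊕ offset j i)
    ; leaves-uniq = tabulate⁺ (λ eq → proj₂ (offset-injective (⊕-cancelˡ (offset-< j _) (offset-< j _) eq)))
    ; centre∉     = x∉leaves
    }
    where
    x∉leaves : x ∈ tabulate (λ i → x ⊕ offset j i) → ⊥
    x∉leaves x∈ with ∈-tabulate⁻ x∈
    ... | i , x≡ = >⇒≢ (offset-positive j i)
      (⊕-cancelˡ (offset-< j i) (>-nonZero⁻¹ N) (trans (sym x≡) (sym (⊕-identityʳ x))))

  Spoke⇒HasEdge : ∀ {j u v} → Spoke j u v → HasEdge (star (j , u)) u v
  Spoke⇒HasEdge {j} {u} (i , refl) = inj₁ (refl , ∈-tabulate⁺ {f = λ i → u ⊕ offset j i} i)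

  star-unique : ∀ {j u v} p → Spoke j u v → HasEdge (star p) u v → p ≡ (j , u)
  star-unique {j} {u} (j′ , x) (i , v≡) (inj₁ (refl , v∈)) with ∈-tabulate⁻ v∈
  ... | i′ , v≡′ = cong (_, u) (sym (proj₁ (offset-injective
                   (⊕-cancelˡ (offset-< j i) (offset-< j′ i′) (trans (sym v≡) v≡′)))))
  star-unique {j} {u} {v} (j′ , x) (i , v≡) (inj₂ (refl , u∈)) with ∈-tabulate⁻ u∈
  ... | i′ , u≡ = contradiction
    (⊕-period u (+-mono-≤ (offset-positive j i) z≤n) (+-mono-< (offset-< j i) (offset-< j′ i′)) round-trip)
    (offset-sum≢N j i j′ i′)
    where
    round-trip : u ⊕ (offset j i + offset j′ i′) ≡ u
    round-trip = begin
      u ⊕ (offset j i + offset j′ i′)  ≡⟨ ⊕-assoc u (offset j i) (offset j′ i′) ⟨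
      u ⊕ offset j i ⊕ offset j′ i′    ≡⟨ cong (_⊕ offset j′ i′) v≡ ⟨
      v ⊕ offset j′ i′                 ≡⟨ u≡ ⟨
      u                                ∎
      where open ≡-Reasoning

  difference-positive : ∀ {u v d} → u ≢ v → u ⊕ d ≡ v → 0 < d
  difference-positive {u} {d = zero}  u≢v eq = contradiction (trans (sym (⊕-identityʳ u)) eq) u≢v
  difference-positive {d = suc d} u≢v eq = z<s

  spoke : ∀ {u v} → u ≢ v → ∃[ j ] (Spoke j u v ⊎ Spoke j v u)
  spoke {u} {v} u≢v with difference u v | difference v u
  ... | d , d<N , u⊕d | d′ , d′<N , v⊕d′ with offset-covers 0<d 0<d′ d+d′≡N
    where
    0<d : 0 < d
    0<d = difference-positive u≢v u⊕d
    0<d′ : 0 < d′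
    0<d′ = difference-positive (u≢v ∘ sym) v⊕d′
    d+d′≡N : d + d′ ≡ N
    d+d′≡N = ⊕-period u (+-mono-≤ 0<d z≤n) (+-mono-< d<N d′<N)
      (trans (sym (⊕-assoc u d d′)) (trans (cong (_⊕ d′) u⊕d) v⊕d′))
  ... | inj₁ (j , i , refl) = j , inj₁ (i , sym u⊕d)
  ... | inj₂ (j , i , refl) = j , inj₂ (i , sym v⊕d′)

  open Enumeration (*↔× {G} {N}) star public renaming (list to blocks)

  Spoke⇒ExactlyOne : ∀ {j u v} → Spoke j u v → ExactlyOne blocks u v
  Spoke⇒ExactlyOne {j} {u} {v} sp =
    slot (j , u) ,
    subst (λ s → HasEdge s u v) (sym (lookup-slot (j , u))) (Spoke⇒HasEdge sp) ,
    λ k h → label-injective (trans (star-unique (label k) sp (subst (λ s → HasEdge s u v) (lookup-list k) h))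
                                   (sym (label-slot (j , u))))

  blocks-isStarSystem : IsStarSystem blocks
  blocks-isStarSystem u v u≢v with spoke u≢v
  ... | j , inj₁ sp = Spoke⇒ExactlyOne sp
  ... | j , inj₂ sp = ExactlyOne-sym {B = blocks} (Spoke⇒ExactlyOne sp)

module OddOffsets (e G : ℕ) .{{_ : NonZero e}} .{{_ : NonZero G}} where

  n′ N : ℕ
  n′ = 2 * (e * G)
  N = suc n′

  offset : Fin G → Fin e → ℕ
  offset j i = suc (2 * toℕ (combine i j))

  offset-< : ∀ j i → offset j i < N
  offset-< j i = s≤s (*-monoʳ-< 2 (toℕ<n (combine i j)))

  offset-injective : ∀ {j i j′ i′} → offset j i ≡ offset j′ i′ → j ≡ j′ × i ≡ i′
  offset-injective {j} {i} {j′} {i′} eq with combine-injective i j i′ j′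
    (toℕ-injective (*-cancelˡ-≡ _ _ 2 (suc-injective eq)))
  ... | i≡i′ , j≡j′ = j≡j′ , i≡i′

  odd-offset : ∀ {t} → suc (2 * t) < N → ∃[ j ] ∃[ i ] offset j i ≡ suc (2 * t)
  odd-offset {t} lt = proj₂ ji , proj₁ ji , cong (suc ∘ (2 *_)) (begin
    toℕ (combine (proj₁ ji) (proj₂ ji))  ≡⟨ cong toℕ (combine-remQuot {e} G k) ⟩
    toℕ k                                ≡⟨ toℕ-fromℕ< t<eG ⟩
    t                                    ∎)
    where
    open ≡-Reasoning
    t<eG : t < e * G
    t<eG = *-cancelˡ-< 2 t (e * G) (≤-pred lt)
    k : Fin (e * G)
    k = fromℕ< t<eG
    ji : Fin e × Fin G
    ji = remQuot G k

  offset-covers : ∀ {d d′} → 0 < d → 0 < d′ → d + d′ ≡ N →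
                  (∃[ j ] ∃[ i ] offset j i ≡ d) ⊎ (∃[ j ] ∃[ i ] offset j i ≡ d′)
  offset-covers {d} {d′} 0<d 0<d′ d+d′≡N with even-or-odd d | even-or-odd d′
  ... | inj₂ (t , refl) | _ = inj₁ (odd-offset {t} (subst (d <_) d+d′≡N (m<m+n d 0<d′)))
  ... | inj₁ _ | inj₂ (t , refl) = inj₂ (odd-offset {t} (subst (d′ <_) d+d′≡N (m<n+m d′ 0<d)))
  ... | inj₁ (t , refl) | inj₁ (t′ , refl) =
    contradiction (trans (*-distribˡ-+ 2 t t′) d+d′≡N) (even≢odd (t + t′) (e * G))

  offset-sum≢N : ∀ j i j′ i′ → offset j i + offset j′ i′ ≢ N
  offset-sum≢N j i j′ i′ eq = even≢odd (e * G) (a + b) (begin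
    2 * (e * G)                   ≡⟨ suc-injective eq ⟨
    2 * a + suc (2 * b)           ≡⟨ +-suc (2 * a) (2 * b) ⟩
    suc (2 * a + 2 * b)           ≡⟨ cong suc (*-distribˡ-+ 2 a b) ⟨
    suc (2 * (a + b))             ∎)
    where
    open ≡-Reasoning
    a b : ℕ
    a = toℕ (combine i j)
    b = toℕ (combine i′ j′)

  open CyclicStarSystem N e G offset (λ _ _ → z<s) offset-< offset-injective offset-covers offset-sum≢N public
  open Cyclic N

  colour : Fin G × Fin N → Fin N
  colour (j , x) = x ⊕ suc (toℕ j)

  data Position (j : Fin G) (α : ℕ) : Set where
    at-centre : α ≡ n′ ∸ toℕ j → Position j α
    at-leaf   : ∀ (i : Fin e) → α ≡ toℕ j + 2 * toℕ i * G → Position j α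

  toℕ≤n′ : ∀ (j : Fin G) → toℕ j ≤ n′
  toℕ≤n′ j = ≤-trans (<⇒≤ (toℕ<n j)) (≤-trans (m≤n*m G e) (m≤n*m (e * G) 2))

  leaf+<n′ : ∀ (j : Fin G) (i : Fin e) (j′ : Fin G) → toℕ j + 2 * toℕ i * G + toℕ j′ < n′
  leaf+<n′ j i j′ = begin-strict
    J + 2 * I * G + J′       ≡⟨ solve 4 (λ J I G J′ → J :+ con 2 :* I :* G :+ J′ := con 2 :* I :* G :+ (J :+ J′)) refl J I G J′ ⟩
    2 * I * G + (J + J′)     <⟨ +-monoʳ-< (2 * I * G) (+-mono-< (toℕ<n j) (toℕ<n j′)) ⟩
    2 * I * G + (G + G)      ≡⟨ solve 2 (λ I G → con 2 :* I :* G :+ (G :+ G) := con 2 :* (con 1 :+ I) :* G) refl I G ⟩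
    2 * suc I * G            ≤⟨ *-monoˡ-≤ G (*-monoʳ-≤ 2 (toℕ<n i)) ⟩
    2 * e * G                ≡⟨ *-assoc 2 e G ⟩
    n′                       ∎
    where
    open ≤-Reasoning
    open +-*-Solver
    J I J′ : ℕ
    J = toℕ j
    I = toℕ i
    J′ = toℕ j′

  Position-< : ∀ {j α} → Position j α → α < N
  Position-< {j} (at-centre refl) = s≤s (m∸n≤m n′ (toℕ j))
  Position-< {j} (at-leaf i refl) = s≤s (≤-trans (m≤m+n _ (toℕ j)) (<⇒≤ (leaf+<n′ j i j)))

  leaf-injective : ∀ (j j′ : Fin G) (i i′ : Fin e) →
                   toℕ j + 2 * toℕ i * G ≡ toℕ j′ + 2 * toℕ i′ * G → j ≡ j′
  leaf-injective j j′ i i′ eq = toℕ-injective (begin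
    toℕ j                         ≡⟨ m<n⇒m%n≡m (toℕ<n j) ⟨
    toℕ j % G                     ≡⟨ [m+kn]%n≡m%n (toℕ j) (2 * toℕ i) G ⟨
    (toℕ j + 2 * toℕ i * G) % G   ≡⟨ cong (_% G) eq ⟩
    (toℕ j′ + 2 * toℕ i′ * G) % G ≡⟨ [m+kn]%n≡m%n (toℕ j′) (2 * toℕ i′) G ⟩
    toℕ j′ % G                    ≡⟨ m<n⇒m%n≡m (toℕ<n j′) ⟩
    toℕ j′                        ∎)
    where open ≡-Reasoning

  centre≢leaf : ∀ (j j′ : Fin G) (i′ : Fin e) {α} → α ≡ n′ ∸ toℕ j → α ≢ toℕ j′ + 2 * toℕ i′ * G
  centre≢leaf j j′ i′ refl eq = <⇒≢ (leaf+<n′ j′ i′ j) (begin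
    toℕ j′ + 2 * toℕ i′ * G + toℕ j  ≡⟨ cong (_+ toℕ j) eq ⟨
    n′ ∸ toℕ j + toℕ j               ≡⟨ m∸n+n≡m (toℕ≤n′ j) ⟩
    n′                               ∎)
    where open ≡-Reasoning

  Position-unique : ∀ {j j′ α} → Position j α → Position j′ α → j ≡ j′
  Position-unique {j} {j′} (at-centre eq) (at-centre eq′) =
    toℕ-injective (∸-cancelˡ-≡ (toℕ≤n′ j) (toℕ≤n′ j′) (trans (sym eq) eq′))
  Position-unique {j} {j′} (at-centre eq) (at-leaf i′ eq′) = contradiction eq′ (centre≢leaf j j′ i′ eq)
  Position-unique {j} {j′} (at-leaf i eq) (at-centre eq′) = contradiction eq (centre≢leaf j′ j i eq′)
  Position-unique {j} {j′} (at-leaf i eq) (at-leaf i′ eq′) = leaf-injective j j′ i i′ (trans (sym eq) eq′)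

  vertex-position : ∀ {j x v} → HasVertex (star (j , x)) v → ∃[ α ] Position j α × v ≡ colour (j , x) ⊕ α
  vertex-position {j} {x} (inj₁ refl) =
    n′ ∸ toℕ j , at-centre refl , sym (⊕-⊕∸ x (s≤s (toℕ≤n′ j)))
  vertex-position {j} {x} (inj₂ v∈) with ∈-tabulate⁻ v∈
  ... | i , refl = toℕ j + 2 * toℕ i * G , at-leaf i refl , (begin
    x ⊕ offset j i                                ≡⟨ cong (x ⊕_) shift ⟩
    x ⊕ (suc (toℕ j) + (toℕ j + 2 * toℕ i * G))   ≡⟨ ⊕-assoc x (suc (toℕ j)) _ ⟨
    colour (j , x) ⊕ (toℕ j + 2 * toℕ i * G)      ∎)
    where
    open ≡-Reasoning
    open +-*-Solver
    shift : offset j i ≡ suc (toℕ j) + (toℕ j + 2 * toℕ i * G)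
    shift = trans (cong (suc ∘ (2 *_)) (toℕ-combine i j))
      (solve 3 (λ J I G → con 1 :+ con 2 :* (G :* I :+ J) := (con 1 :+ J) :+ (J :+ con 2 :* I :* G))
             refl (toℕ j) (toℕ i) G)

  colour-disjoint : ∀ p q → p ≢ q → colour p ≡ colour q → VertexDisjoint (star p) (star q)
  colour-disjoint (j , x) (j′ , x′) p≢q same-colour (v , v∈p , v∈q)
    with vertex-position v∈p | vertex-position v∈q
  ... | α , Pα , v≡ | β , Pβ , v≡′ with Position-unique Pα (subst (Position j′) (sym α≡β) Pβ)
    where
    α≡β : α ≡ β
    α≡β = ⊕-cancelˡ {colour (j , x)} (Position-< Pα) (Position-< Pβ)
            (trans (sym v≡) (trans v≡′ (cong (_⊕ β) (sym same-colour))))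
  ... | refl = p≢q (cong (j ,_) (⊕-cancelʳ (s≤s (toℕ≤n′ j)) same-colour))

  blocks-colourable : BlockColourable blocks N
  blocks-colourable = colour ∘ label , surjective , disjoint
    where
    j₀ : Fin G
    j₀ = fromℕ< (>-nonZero⁻¹ G)
    surjective : ∀ y → ∃ λ k → ∀ {l} → l ≡ k → colour (label l) ≡ y
    surjective y = slot (j₀ , y ⊕ (N ∸ suc (toℕ j₀))) , λ { refl →
      trans (cong colour (label-slot _)) (⊕-∸⊕ y (s≤s (toℕ≤n′ j₀))) }
    disjoint : ∀ k l → k ≢ l → colour (label k) ≡ colour (label l) →
               VertexDisjoint (lookup blocks k) (lookup blocks l)
    disjoint k l k≢l same-colour =
      subst₂ VertexDisjoint (sym (lookup-list k)) (sym (lookup-list l))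
        (colour-disjoint (label k) (label l) (k≢l ∘ label-injective) same-colour)

starSystem-colourable : ∀ e G .{{_ : NonZero e}} .{{_ : NonZero G}} →
  ∃[ B ] (IsStarSystem {suc (2 * (e * G))} {e} B × BlockColourable B (suc (2 * (e * G))))
starSystem-colourable e G = blocks , blocks-isStarSystem , blocks-colourable
  where open OddOffsets e G

starSystem-colourable-2e : ∀ e n → 0 < e → 1 < n → (2 * e) ∣ (n ∸ 1) →
  ∃[ B ] (IsStarSystem {n} {e} B × BlockColourable B n)
starSystem-colourable-2e e (suc (suc m)) 0<e (s≤s (s≤s z≤n)) (divides (suc q) eq) =
  subst (λ n → ∃[ B ] (IsStarSystem {n} {e} B × BlockColourable B n)) (cong suc (sym n∸1≡))
    (starSystem-colourable e (suc q) {{>-nonZero 0<e}})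
  where
  open +-*-Solver
  n∸1≡ : suc m ≡ 2 * (e * suc q)
  n∸1≡ = trans eq (solve 2 (λ q e → q :* (con 2 :* e) := con 2 :* (e :* q)) refl (suc q) e)

theorem3p2 : ∀ (e n : ℕ) → 3 ≤ e → 1 < n → (4 * e) ∣ (n ∸ 1) →
    ∃[ B ] (IsStarSystem {n} {e} B × BlockColourable B n)
theorem3p2 e n 3≤e 1<n 4e∣n∸1 =
  starSystem-colourable-2e e n (<-≤-trans z<s 3≤e) 1<n (∣-trans (divides 2 (*-assoc 2 2 e)) 4e∣n∸1)
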